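{- Let $q$ be a prime number and let $h$ be a positive integer coprime to $q-1$. Let $l$ be the multiplicative order of $h$ modulo $q-1$. Then there exists $a\in\mathbb{F}_q$ such that $a^{h^l}=a$ and $$a-a^{h}+a^{h^2}-\dots+(-1)^{l-1}a^{h^{l-1}}\neq 0.$$ -}

module Defs where

open import Data.Nat as ℕ using (ℕ; zero; suc; _<_; _≤_)
open import Data.Integer as ℤ using (ℤ; +_; _-_; _*_; -_)
open import Data.Integer.Divisibility using (_∣_)
open import Relation.Nullary using (¬_)
open import Data.Product using (_×_)

_≡_[mod_] : ℤ → ℤ → ℕ → Set
a ≡ b [mod n ] = (+ n) ∣ (a - b)

_^ᶻ_ : ℤ → ℕ → ℤ
a ^ᶻ zero = + 1
a ^ᶻ suc k = a * (a ^ᶻ k)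

IsMultOrder : ℕ → ℕ → ℕ → Set
IsMultOrder h n l =
  (0 < l) × ((+ (h ℕ.^ l)) ≡ (+ 1) [mod n ]) ×
  (∀ k → 0 < k → (+ (h ℕ.^ k)) ≡ (+ 1) [mod n ] → l ≤ k)

altSum : ℤ → ℕ → ℕ → ℤ
altSum a h zero = + 0
altSum a h (suc l) = altSum a h l ℤ.+ ((- (+ 1)) ^ᶻ l) * (a ^ᶻ (h ℕ.^ l))

-- Write p for the prime q and S j = Σ_{a ∈ 𝔽_p} a^j.  Telescoping Σ_a ((a+1)^{j+1} − a^{j+1}) = p^{j+1} ≡ 0
-- and expanding binomially shows by induction that S j ≡ 0 for j < p − 1, while Fermat gives
-- S (p − 1) ≡ −1 and makes S periodic with period p − 1 on positive exponents.  Hence for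
-- f(x) = Σ_{i<l} (−1)^i x^{h^i} we get Σ_a a^{p−2} f(a) = Σ_{i<l} (−1)^i S (p − 2 + h^i) ≡ −1,
-- because p − 1 divides p − 2 + h^i only for i = 0 by minimality of the order l.  So f does not
-- vanish on all of 𝔽_p, and every a satisfies a^{h^l} = a as h^l ≡ 1 (mod p − 1).
module Submission where

open import Defs
open import Data.Nat using (ℕ; _<_)
open import Data.Nat.Primality using (Prime)
open import Data.Integer using (+_)
open import Relation.Nullary using (¬_)

open import Algebra.Bundles using (CommutativeSemiring; CommutativeRing)
open import Data.Nat as ℕ using (zero; suc; _≤_; s≤s; z<s; NonZero)
import Data.Nat.Properties as ℕ
open import Data.Nat.Combinatorics using (_C_; nCn≡1; nC1≡n; nCk≡nC[n∸k]; nCk+nC[k+1]≡[n+1]C[k+1])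
open import Data.Nat.Divisibility as ℕ using (divides; m∣m*n; >⇒∤; m%n≡0⇒n∣m)
open import Data.Nat.DivMod using (_%_; _/_; m≡m%n+[m/n]*n; m%n<n)
open import Data.Nat.Induction using (<-rec)
open import Data.Nat.Primality using (euclidsLemma; ¬prime[0]; ¬prime[1])
import Data.Nat.Tactic.RingSolver as ℕ-Solver
open import Data.Integer as ℤ using (ℤ; 0ℤ; 1ℤ; ∣_∣)
import Data.Integer.Properties as ℤ
import Data.Integer.Divisibility.Signed as Signed
open import Data.Integer.Tactic.RingSolver using (solve-∀)
open import Data.Fin as Fin using (Fin; toℕ; inject₁; fromℕ)
open import Data.Fin.Properties using (toℕ<n; toℕ-fromℕ; toℕ-inject₁; inject₁ℕ<; ¬∀⟶∃¬)
open import Data.Vec.Functional using (Vector)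
open import Data.Product using (∃; _,_)
open import Data.Sum using (inj₁; inj₂)
open import Function using (_∘_)
open import Level using (0ℓ)
open import Relation.Binary.PropositionalEquality as ≡ using (_≡_; cong; cong₂; subst)
open import Relation.Nullary using (Dec; contradiction)
import Relation.Nullary.Decidable as Dec

[k+1]*[n+1]C[k+1]≡[n+1]*nCk : ∀ n k → suc k ℕ.* (suc n C suc k) ≡ suc n ℕ.* (n C k)
[k+1]*[n+1]C[k+1]≡[n+1]*nCk zero    zero    = ≡.refl
[k+1]*[n+1]C[k+1]≡[n+1]*nCk zero    (suc k) = ℕ.*-zeroʳ (suc (suc k))
[k+1]*[n+1]C[k+1]≡[n+1]*nCk (suc n) zero    =
  ≡.trans (ℕ.+-identityʳ _) (≡.trans (nC1≡n (suc (suc n))) (≡.sym (ℕ.*-identityʳ (suc (suc n)))))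
[k+1]*[n+1]C[k+1]≡[n+1]*nCk (suc n) (suc k) = begin
  suc (suc k) ℕ.* (suc (suc n) C suc (suc k))
    ≡⟨ cong (suc (suc k) ℕ.*_) (nCk+nC[k+1]≡[n+1]C[k+1] (suc n) (suc k)) ⟨
  suc (suc k) ℕ.* (suc n C suc k ℕ.+ suc n C suc (suc k))
    ≡⟨ ℕ.*-distribˡ-+ (suc (suc k)) (suc n C suc k) _ ⟩
  suc (suc k) ℕ.* (suc n C suc k) ℕ.+ suc (suc k) ℕ.* (suc n C suc (suc k))
    ≡⟨ cong (suc (suc k) ℕ.* (suc n C suc k) ℕ.+_) ([k+1]*[n+1]C[k+1]≡[n+1]*nCk n (suc k)) ⟩
  suc n C suc k ℕ.+ suc k ℕ.* (suc n C suc k) ℕ.+ suc n ℕ.* (n C suc k)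
    ≡⟨ cong (λ c → suc n C suc k ℕ.+ c ℕ.+ suc n ℕ.* (n C suc k)) ([k+1]*[n+1]C[k+1]≡[n+1]*nCk n k) ⟩
  suc n C suc k ℕ.+ suc n ℕ.* (n C k) ℕ.+ suc n ℕ.* (n C suc k)
    ≡⟨ ℕ.+-assoc (suc n C suc k) _ _ ⟩
  suc n C suc k ℕ.+ (suc n ℕ.* (n C k) ℕ.+ suc n ℕ.* (n C suc k))
    ≡⟨ cong (suc n C suc k ℕ.+_) (ℕ.*-distribˡ-+ (suc n) (n C k) _) ⟨
  suc n C suc k ℕ.+ suc n ℕ.* (n C k ℕ.+ n C suc k)
    ≡⟨ cong (λ c → suc n C suc k ℕ.+ suc n ℕ.* c) (nCk+nC[k+1]≡[n+1]C[k+1] n k) ⟩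
  suc (suc n) ℕ.* (suc n C suc k) ∎
  where open ≡.≡-Reasoning

p∣pCk : ∀ {p k} → Prime p → 0 < k → k < p → p ℕ.∣ p C k
p∣pCk {suc n} {suc k} p-prime _ k<p
  with euclidsLemma (suc k) (suc n C suc k) p-prime
         (subst (suc n ℕ.∣_) (≡.sym ([k+1]*[n+1]C[k+1]≡[n+1]*nCk n k)) (m∣m*n (n C k)))
... | inj₁ p∣k  = contradiction p∣k (>⇒∤ k<p)
... | inj₂ p∣pCk = p∣pCk

module CommutativeSemiringLemmas {c ℓ} (R : CommutativeSemiring c ℓ) where

  open CommutativeSemiring R hiding (zero)
  open import Algebra.Properties.Semiring.Exp semiring
  open import Algebra.Properties.Semiring.Mult semiring
  open import Algebra.Properties.Semiring.Sum semiring
  open import Algebra.Properties.CommutativeSemiring.Binomial R using (theorem)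
  open import Relation.Binary.Reasoning.Setoid setoid

  ×-zeroʳ : ∀ m → m × 0# ≈ 0#
  ×-zeroʳ m = trans (sym (sum-replicate m)) (sum-replicate-zero m)

  sum-≈0 : ∀ {n} (f : Vector Carrier n) → (∀ i → f i ≈ 0#) → sum f ≈ 0#
  sum-≈0 {n} f f≈0 = trans (sum-cong-≋ f≈0) (sum-replicate-zero n)

  ×-distribˡ-sum : ∀ {n} m (f : Vector Carrier n) → m × sum f ≈ ∑[ i < n ] (m × f i)
  ×-distribˡ-sum {n} m f = begin
    m × sum f                    ≈⟨ ×-congʳ m (*-identityˡ (sum f)) ⟨
    m × (1# * sum f)             ≈⟨ ×-assoc-* m 1# (sum f) ⟨
    (m × 1#) * sum f             ≈⟨ *-distribˡ-sum (m × 1#) f ⟩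
    ∑[ i < n ] ((m × 1#) * f i)  ≈⟨ sum-cong-≋ (λ i → trans (×-assoc-* m 1# (f i)) (×-congʳ m (*-identityˡ (f i)))) ⟩
    ∑[ i < n ] (m × f i)         ∎

  1^n≈1 : ∀ n → 1# ^ n ≈ 1#
  1^n≈1 zero    = refl
  1^n≈1 (suc n) = trans (*-identityˡ _) (1^n≈1 n)

  [x+1]^n≈∑[k<n]nCk×x^k+x^n : ∀ n x → (x + 1#) ^ n ≈ ∑[ k < n ] ((n C toℕ k) × x ^ toℕ k) + x ^ n
  [x+1]^n≈∑[k<n]nCk×x^k+x^n n x = begin
    (x + 1#) ^ n                                    ≈⟨ theorem n x 1# ⟩
    ∑[ k ≤ n ] term k                               ≈⟨ sum-init-last term ⟩
    ∑[ k < n ] term (inject₁ k) + term (fromℕ n)    ≈⟨ +-cong (sum-cong-≋ lower) top ⟩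
    ∑[ k < n ] ((n C toℕ k) × x ^ toℕ k) + x ^ n    ∎
    where
    term : Fin (suc n) → Carrier
    term k = (n C toℕ k) × (x ^ toℕ k * 1# ^ (n ℕ.∸ toℕ k))
    lower : ∀ k → term (inject₁ k) ≈ (n C toℕ k) × x ^ toℕ k
    lower k rewrite toℕ-inject₁ k = ×-congʳ (n C toℕ k) (trans (*-congˡ (1^n≈1 (n ℕ.∸ toℕ k))) (*-identityʳ _))
    top : term (fromℕ n) ≈ x ^ n
    top rewrite toℕ-fromℕ n | nCn≡1 n | ℕ.n∸n≡0 n = trans (+-identityʳ _) (*-identityʳ _)

  p∣m⇒m×x≈0 : ∀ {p m} → p × 1# ≈ 0# → ∀ x → p ℕ.∣ m → m × x ≈ 0#
  p∣m⇒m×x≈0 {p} p×1≈0 x (divides q ≡.refl) = begin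
    (q ℕ.* p) × x        ≈⟨ ×-assocˡ x q p ⟨
    q × (p × x)          ≈⟨ ×-congʳ q (×-congʳ p (*-identityˡ x)) ⟨
    q × (p × (1# * x))   ≈⟨ ×-congʳ q (×-assoc-* p 1# x) ⟨
    q × ((p × 1#) * x)   ≈⟨ ×-congʳ q (trans (*-congʳ p×1≈0) (zeroˡ x)) ⟩
    q × 0#               ≈⟨ ×-zeroʳ q ⟩
    0#                   ∎

  [x+y]^p≈x^p+y^p : ∀ {p} → Prime p → p × 1# ≈ 0# → ∀ x y → (x + y) ^ p ≈ x ^ p + y ^ p
  [x+y]^p≈x^p+y^p {zero}  p-prime _ = contradiction p-prime ¬prime[0]
  [x+y]^p≈x^p+y^p {suc m} p-prime p×1≈0 x y = begin
    (x + y) ^ suc m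
      ≈⟨ theorem (suc m) x y ⟩
    term Fin.zero + ∑[ k < suc m ] term (Fin.suc k)
      ≈⟨ +-congˡ (sum-init-last (term ∘ Fin.suc)) ⟩
    term Fin.zero + (∑[ k < m ] term (Fin.suc (inject₁ k)) + term (Fin.suc (fromℕ m)))
      ≈⟨ +-cong bottom (+-cong (sum-≈0 _ middle) top) ⟩
    y ^ suc m + (0# + x ^ suc m)
      ≈⟨ trans (+-congˡ (+-identityˡ _)) (+-comm _ _) ⟩
    x ^ suc m + y ^ suc m ∎
    where
    term : Fin (suc (suc m)) → Carrier
    term k = (suc m C toℕ k) × (x ^ toℕ k * y ^ (suc m ℕ.∸ toℕ k))
    bottom : term Fin.zero ≈ y ^ suc m
    bottom = trans (+-identityʳ _) (*-identityˡ _)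
    middle : ∀ k → term (Fin.suc (inject₁ k)) ≈ 0#
    middle k = p∣m⇒m×x≈0 p×1≈0 _ (p∣pCk p-prime z<s (s≤s (inject₁ℕ< k)))
    top : term (Fin.suc (fromℕ m)) ≈ x ^ suc m
    top rewrite toℕ-fromℕ m | nCn≡1 (suc m) | ℕ.n∸n≡0 m = trans (+-identityʳ _) (*-identityʳ _)

  [m×1]^p≈m×1 : ∀ {p} → Prime p → p × 1# ≈ 0# → ∀ m → (m × 1#) ^ p ≈ m × 1#
  [m×1]^p≈m×1 {zero}  p-prime _ _           = contradiction p-prime ¬prime[0]
  [m×1]^p≈m×1 {suc k} _       _ zero        = zeroˡ _
  [m×1]^p≈m×1 {suc k} p-prime p×1≈0 (suc m) = begin
    (1# + m × 1#) ^ suc k           ≈⟨ [x+y]^p≈x^p+y^p p-prime p×1≈0 1# (m × 1#) ⟩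
    1# ^ suc k + (m × 1#) ^ suc k   ≈⟨ +-cong (1^n≈1 (suc k)) ([m×1]^p≈m×1 p-prime p×1≈0 m) ⟩
    1# + m × 1#                     ∎

  x^[1+m]≈x⇒x^[1+k+t*m]≈x^[1+k] : ∀ {x m} → x ^ suc m ≈ x → ∀ k t → x ^ (suc k ℕ.+ t ℕ.* m) ≈ x ^ suc k
  x^[1+m]≈x⇒x^[1+k+t*m]≈x^[1+k] {x} {m} _ k zero = ^-congʳ x (ℕ.+-identityʳ (suc k))
  x^[1+m]≈x⇒x^[1+k+t*m]≈x^[1+k] {x} {m} x^[1+m]≈x k (suc t) = begin
    x ^ (suc k ℕ.+ (m ℕ.+ t ℕ.* m))   ≡⟨ cong (x ^_) (exponent m k t) ⟩
    x ^ ((k ℕ.+ t ℕ.* m) ℕ.+ suc m)   ≈⟨ ^-homo-* x (k ℕ.+ t ℕ.* m) (suc m) ⟩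
    x ^ (k ℕ.+ t ℕ.* m) * x ^ suc m   ≈⟨ trans (*-congˡ x^[1+m]≈x) (*-comm _ x) ⟩
    x ^ (suc k ℕ.+ t ℕ.* m)           ≈⟨ x^[1+m]≈x⇒x^[1+k+t*m]≈x^[1+k] x^[1+m]≈x k t ⟩
    x ^ suc k                         ∎
    where
    exponent : ∀ m k t → suc k ℕ.+ (m ℕ.+ t ℕ.* m) ≡ (k ℕ.+ t ℕ.* m) ℕ.+ suc m
    exponent = ℕ-Solver.solve-∀

module CommutativeRingLemmas {c ℓ} (R : CommutativeRing c ℓ) where

  open CommutativeRing R
  open import Algebra.Properties.Semiring.Sum semiring using (sum-syntax)
  open import Algebra.Properties.Group +-group using (\\-leftDividesʳ)
  open import Relation.Binary.Reasoning.Setoid setoid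

  ∑-telescope : ∀ n (g : ℕ → Carrier) → ∑[ i < n ] (g (suc (toℕ i)) - g (toℕ i)) ≈ g n - g 0
  ∑-telescope zero    g = sym (-‿inverseʳ (g 0))
  ∑-telescope (suc n) g = begin
    (g 1 - g 0) + ∑[ i < n ] (g (2 ℕ.+ toℕ i) - g (suc (toℕ i)))  ≈⟨ +-congˡ (∑-telescope n (g ∘ suc)) ⟩
    (g 1 - g 0) + (g (suc n) - g 1)                                ≈⟨ +-comm _ _ ⟩
    (g (suc n) - g 1) + (g 1 - g 0)                                ≈⟨ +-assoc _ _ _ ⟩
    g (suc n) + (- g 1 + (g 1 - g 0))                              ≈⟨ +-congˡ (\\-leftDividesʳ (g 1) (- g 0)) ⟩
    g (suc n) - g 0                                                ∎

-- A record rather than the bare congruence, so that Agda can infer both sides of an equation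
-- from its type instead of getting stuck on the computation of ∣ x - y ∣.
record ModEq (n : ℕ) (x y : ℤ) : Set where
  constructor mod
  field unmod : x ≡ y [mod n ]

module _ (n : ℕ) where

  private
    infix 4 _≈_
    _≈_ : ℤ → ℤ → Set
    _≈_ = ModEq n

    ∣⇒≈ : ∀ x y {d} → d ≡ x ℤ.- y → + n Signed.∣ d → x ≈ y
    ∣⇒≈ x y d≡x-y n∣d = mod (Signed.∣⇒∣ᵤ (subst (+ n Signed.∣_) d≡x-y n∣d))

    ≈⇒∣ : ∀ x y → x ≈ y → + n Signed.∣ x ℤ.- y
    ≈⇒∣ x y (mod x≡y) = Signed.∣ᵤ⇒∣ x≡y

    reflexive : ∀ {x y} → x ≡ y → x ≈ y
    reflexive {x} ≡.refl = ∣⇒≈ x x (≡.sym (ℤ.+-inverseʳ x)) (Signed.∣n⇒∣m*n 0ℤ Signed.∣-refl)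

    ≈-sym : ∀ x y → x ≈ y → y ≈ x
    ≈-sym x y x≈y = ∣⇒≈ y x (-[x-y]≡y-x x y) (Signed.∣m⇒∣-m (≈⇒∣ x y x≈y))
      where
      -[x-y]≡y-x : ∀ x y → ℤ.- (x ℤ.- y) ≡ y ℤ.- x
      -[x-y]≡y-x = solve-∀

    ≈-trans : ∀ x y z → x ≈ y → y ≈ z → x ≈ z
    ≈-trans x y z x≈y y≈z = ∣⇒≈ x z ([x-y]+[y-z]≡x-z x y z) (Signed.∣m∣n⇒∣m+n (≈⇒∣ x y x≈y) (≈⇒∣ y z y≈z))
      where
      [x-y]+[y-z]≡x-z : ∀ x y z → (x ℤ.- y) ℤ.+ (y ℤ.- z) ≡ x ℤ.- z
      [x-y]+[y-z]≡x-z = solve-∀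

    +-cong : ∀ x x′ y y′ → x ≈ x′ → y ≈ y′ → x ℤ.+ y ≈ x′ ℤ.+ y′
    +-cong x x′ y y′ x≈x′ y≈y′ = ∣⇒≈ (x ℤ.+ y) (x′ ℤ.+ y′) (regroup x x′ y y′)
      (Signed.∣m∣n⇒∣m+n (≈⇒∣ x x′ x≈x′) (≈⇒∣ y y′ y≈y′))
      where
      regroup : ∀ x x′ y y′ → (x ℤ.- x′) ℤ.+ (y ℤ.- y′) ≡ (x ℤ.+ y) ℤ.- (x′ ℤ.+ y′)
      regroup = solve-∀

    *-cong : ∀ x x′ y y′ → x ≈ x′ → y ≈ y′ → x ℤ.* y ≈ x′ ℤ.* y′
    *-cong x x′ y y′ x≈x′ y≈y′ = ∣⇒≈ (x ℤ.* y) (x′ ℤ.* y′) (regroup x x′ y y′)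
      (Signed.∣m∣n⇒∣m+n (Signed.∣m⇒∣m*n y (≈⇒∣ x x′ x≈x′)) (Signed.∣n⇒∣m*n x′ (≈⇒∣ y y′ y≈y′)))
      where
      regroup : ∀ x x′ y y′ → (x ℤ.- x′) ℤ.* y ℤ.+ x′ ℤ.* (y ℤ.- y′) ≡ x ℤ.* y ℤ.- x′ ℤ.* y′
      regroup = solve-∀

    neg-cong : ∀ x y → x ≈ y → ℤ.- x ≈ ℤ.- y
    neg-cong x y x≈y = ∣⇒≈ (ℤ.- x) (ℤ.- y) (negate-difference x y) (Signed.∣m⇒∣-m (≈⇒∣ x y x≈y))
      where
      negate-difference : ∀ x y → ℤ.- (x ℤ.- y) ≡ ℤ.- x ℤ.- ℤ.- y
      negate-difference = solve-∀

  ℤ/_ℤ : CommutativeRing 0ℓ 0ℓ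
  ℤ/_ℤ = record
    { Carrier = ℤ ; _≈_ = _≈_ ; _+_ = ℤ._+_ ; _*_ = ℤ._*_ ; -_ = ℤ.-_ ; 0# = 0ℤ ; 1# = 1ℤ
    ; isCommutativeRing = record
      { isRing = record
        { +-isAbelianGroup = record
          { isGroup = record
            { isMonoid = record
              { isSemigroup = record
                { isMagma = record
                  { isEquivalence = record
                    { refl  = λ {x} → reflexive {x} ≡.refl
                    ; sym   = λ {x y} → ≈-sym x y
                    ; trans = λ {x y z} → ≈-trans x y z }
                  ; ∙-cong = λ {x x′ y y′} → +-cong x x′ y y′ }
                ; assoc = λ x y z → reflexive (ℤ.+-assoc x y z) }
              ; identity = (λ x → reflexive (ℤ.+-identityˡ x)) , (λ x → reflexive (ℤ.+-identityʳ x)) }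
            ; inverse = (λ x → reflexive (ℤ.+-inverseˡ x)) , (λ x → reflexive (ℤ.+-inverseʳ x))
            ; ⁻¹-cong = λ {x y} → neg-cong x y }
          ; comm = λ x y → reflexive (ℤ.+-comm x y) }
        ; *-cong = λ {x x′ y y′} → *-cong x x′ y y′
        ; *-assoc = λ x y z → reflexive (ℤ.*-assoc x y z)
        ; *-identity = (λ x → reflexive (ℤ.*-identityˡ x)) , (λ x → reflexive (ℤ.*-identityʳ x))
        ; distrib = (λ x y z → reflexive (ℤ.*-distribˡ-+ x y z)) , (λ x y z → reflexive (ℤ.*-distribʳ-+ x y z)) }
      ; *-comm = λ x y → reflexive (ℤ.*-comm x y) } }

-- Here p = n + 2, so n is the weight exponent p − 2 and suc n is p − 1.
module PrimeField (n : ℕ) (p-prime : Prime (suc (suc n))) where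

  p : ℕ
  p = suc (suc n)

  open CommutativeRing ℤ/ p ℤ hiding (zero)
  open CommutativeSemiringLemmas commutativeSemiring
  open CommutativeRingLemmas ℤ/ p ℤ
  open import Algebra.Properties.Semiring.Exp semiring
  open import Algebra.Properties.Semiring.Mult semiring
  open import Algebra.Properties.Semiring.Sum semiring
  open import Algebra.Properties.Group +-group using (//-rightDividesʳ)
  open import Algebra.Properties.CommutativeSemigroup *-commutativeSemigroup using (x∙yz≈y∙xz)
  open import Relation.Binary.Reasoning.Setoid setoid

  m×1≡+m : ∀ m → m × 1# ≡ + m
  m×1≡+m zero    = ≡.refl
  m×1≡+m (suc m) = cong (λ k → 1# + k) (m×1≡+m m)

  +p≈0 : + p ≈ 0#
  +p≈0 = mod (ℕ.∣-reflexive (≡.sym (ℕ.+-identityʳ p)))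

  p×1≈0 : p × 1# ≈ 0#
  p×1≈0 = subst (_≈ 0#) (≡.sym (m×1≡+m p)) +p≈0

  -1≉0 : ¬ (- 1# ≈ 0#)
  -1≉0 (mod p∣1) = contradiction p∣1 (>⇒∤ (s≤s (s≤s ℕ.z≤n)))

  _≈?_ : ∀ x y → Dec (x ≈ y)
  x ≈? y = Dec.map′ mod ModEq.unmod (p ℕ.∣? ∣ x - y ∣)

  [+a]^p≈+a : ∀ a → (+ a) ^ p ≈ + a
  [+a]^p≈+a a = subst (λ x → x ^ p ≈ x) (m×1≡+m a) ([m×1]^p≈m×1 p-prime p×1≈0 a)

  +c*x≈+c*y⇒x≈y : ∀ {c} x y → 0 < c → c < p → + c * x ≈ + c * y → x ≈ y
  +c*x≈+c*y⇒x≈y {suc c} x y _ c<p (mod p∣cx-cy)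
    with euclidsLemma (suc c) ∣ x - y ∣ p-prime
           (subst (p ℕ.∣_) (≡.trans (cong ∣_∣ (factor (+ suc c) x y)) (ℤ.abs-* (+ suc c) (x - y))) p∣cx-cy)
    where
    factor : ∀ c x y → c * x - c * y ≡ c * (x - y)
    factor c x y = ≡.trans (cong (_+_ (c * x)) (ℤ.neg-distribʳ-* c y)) (≡.sym (ℤ.*-distribˡ-+ c x (- y)))
  ... | inj₁ p∣c   = contradiction p∣c (>⇒∤ c<p)
  ... | inj₂ p∣x-y = mod p∣x-y

  S : ℕ → ℤ
  S j = ∑[ a < p ] ((+ toℕ a) ^ j)

  S-recurrence : ∀ m → ∑[ k < suc m ] ((suc m C toℕ k) × S (toℕ k)) ≈ 0#
  S-recurrence m = begin
    ∑[ k < suc m ] (coeff k × S (toℕ k))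
      ≈⟨ sum-cong-≋ expand ⟩
    ∑[ k < suc m ] ∑[ a < p ] (coeff k × (+ toℕ a) ^ toℕ k)
      ≈⟨ ∑-comm {suc m} {p} (λ k a → coeff k × (+ toℕ a) ^ toℕ k) ⟩
    ∑[ a < p ] ∑[ k < suc m ] (coeff k × (+ toℕ a) ^ toℕ k)
      ≈⟨ sum-cong-≋ {p} (λ a → difference (toℕ a)) ⟩
    ∑[ a < p ] ((+ suc (toℕ a)) ^ suc m - (+ toℕ a) ^ suc m)
      ≈⟨ ∑-telescope p (λ a → (+ a) ^ suc m) ⟩
    (+ p) ^ suc m - 0# ^ suc m
      ≈⟨ +-congʳ (^-congˡ (suc m) +p≈0) ⟩
    0# ^ suc m - 0# ^ suc m
      ≈⟨ -‿inverseʳ (0# ^ suc m) ⟩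
    0# ∎
    where
    coeff : Fin (suc m) → ℕ
    coeff k = suc m C toℕ k
    expand : ∀ k → coeff k × S (toℕ k) ≈ ∑[ a < p ] (coeff k × (+ toℕ a) ^ toℕ k)
    expand k = ×-distribˡ-sum {p} (coeff k) (λ a → (+ toℕ a) ^ toℕ k)
    difference : ∀ a → ∑[ k < suc m ] (coeff k × (+ a) ^ toℕ k) ≈ (+ suc a) ^ suc m - (+ a) ^ suc m
    difference a = begin
      s                                      ≈⟨ //-rightDividesʳ ((+ a) ^ suc m) s ⟨
      s + (+ a) ^ suc m - (+ a) ^ suc m      ≈⟨ +-congʳ ([x+1]^n≈∑[k<n]nCk×x^k+x^n (suc m) (+ a)) ⟨
      (+ a + 1#) ^ suc m - (+ a) ^ suc m     ≈⟨ +-congʳ (^-congˡ (suc m) (+-comm (+ a) 1#)) ⟩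
      (+ suc a) ^ suc m - (+ a) ^ suc m      ∎
      where
      s : ℤ
      s = ∑[ k < suc m ] (coeff k × (+ a) ^ toℕ k)

  -- By strong induction: the recurrence for m = j leaves only (j + 1) · S j, and j + 1 is a unit.
  S≈0 : ∀ j → suc j < p → S j ≈ 0#
  S≈0 = <-rec _ λ j earlier 1+j<p → +c*x≈+c*y⇒x≈y (S j) 0# z<s 1+j<p (begin
    + suc j * S j          ≡⟨ cong (_* S j) (m×1≡+m (suc j)) ⟨
    (suc j × 1#) * S j     ≈⟨ ×-assoc-* (suc j) 1# (S j) ⟩
    suc j × (1# * S j)     ≈⟨ ×-congʳ (suc j) (*-identityˡ (S j)) ⟩
    suc j × S j            ≈⟨ [1+j]×S[j]≈0 j earlier 1+j<p ⟩
    0#                     ≈⟨ zeroʳ (+ suc j) ⟨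
    + suc j * 0#           ∎)
    where
    [1+j]×S[j]≈0 : ∀ j → (∀ {i} → i < j → suc i < p → S i ≈ 0#) → suc j < p → suc j × S j ≈ 0#
    [1+j]×S[j]≈0 j earlier 1+j<p = begin
      suc j × S j                                 ≈⟨ +-identityˡ _ ⟨
      0# + suc j × S j                            ≈⟨ +-cong (sum-≈0 _ lower) top ⟨
      ∑[ k < j ] term (inject₁ k) + term (fromℕ j) ≈⟨ sum-init-last term ⟨
      ∑[ k < suc j ] term k                       ≈⟨ S-recurrence j ⟩
      0#                                          ∎
      where
      term : Fin (suc j) → ℤ
      term k = (suc j C toℕ k) × S (toℕ k)
      lower : ∀ k → term (inject₁ k) ≈ 0#
      lower k = trans (×-congʳ (suc j C toℕ (inject₁ k)) (earlier (inject₁ℕ< k) (ℕ.<-trans (s≤s (inject₁ℕ< k)) 1+j<p)))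
                      (×-zeroʳ (suc j C toℕ (inject₁ k)))
      top : term (fromℕ j) ≈ suc j × S j
      top rewrite toℕ-fromℕ j | nCk≡nC[n∸k] (ℕ.n≤1+n j) | ℕ.m+n∸n≡m 1 j | nC1≡n (suc j) = refl

  S[p-1]≈-1 : S (suc n) ≈ - 1#
  S[p-1]≈-1 = begin
    0# ^ suc n + ∑[ a < suc n ] ((+ suc (toℕ a)) ^ suc n)   ≈⟨ +-cong (zeroˡ (0# ^ n)) (sum-cong-≋ unit) ⟩
    0# + ∑[ a < suc n ] 1#                                  ≈⟨ +-identityˡ _ ⟩
    ∑[ a < suc n ] 1#                                       ≈⟨ sum-replicate (suc n) {1#} ⟩
    suc n × 1#                                              ≡⟨ m×1≡+m (suc n) ⟩
    + suc n                                                 ≈⟨ mod (ℕ.∣-reflexive (ℕ.+-comm 1 (suc n))) ⟩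
    - 1#                                                    ∎
    where
    unit : ∀ (a : Fin (suc n)) → (+ suc (toℕ a)) ^ suc n ≈ 1#
    unit a = +c*x≈+c*y⇒x≈y _ 1# z<s (s≤s (toℕ<n a)) (trans ([+a]^p≈+a (suc (toℕ a))) (sym (*-identityʳ _)))

  S-periodic : ∀ k t → S (suc k ℕ.+ t ℕ.* suc n) ≈ S (suc k)
  S-periodic k t = sum-cong-≋ {p} λ a →
    x^[1+m]≈x⇒x^[1+k+t*m]≈x^[1+k] {+ toℕ a} {suc n} ([+a]^p≈+a (toℕ a)) k t

  p-1∤e⇒S[e]≈0 : ∀ e → ¬ (suc n ℕ.∣ e) → S e ≈ 0#
  p-1∤e⇒S[e]≈0 e p-1∤e with e % suc n in e%[p-1]≡r
  ... | zero  = contradiction (m%n≡0⇒n∣m e (suc n) e%[p-1]≡r) p-1∤e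
  ... | suc r = begin
    S e                          ≡⟨ cong S e≡ ⟩
    S (suc r ℕ.+ q ℕ.* suc n)    ≈⟨ S-periodic r q ⟩
    S (suc r)                    ≈⟨ S≈0 (suc r) (s≤s r<p-1) ⟩
    0#                           ∎
    where
    q : ℕ
    q = e / suc n
    e≡ : e ≡ suc r ℕ.+ q ℕ.* suc n
    e≡ = ≡.trans (m≡m%n+[m/n]*n e (suc n)) (cong (ℕ._+ q ℕ.* suc n) e%[p-1]≡r)
    r<p-1 : suc r < suc n
    r<p-1 = subst (_< suc n) e%[p-1]≡r (m%n<n e (suc n))

  -- For e = suc e′ the congruence (+ e) ≡ (+ 1) [mod suc n] unfolds to suc n ∣ e′.
  e≢1⇒S[p-2+e]≈0 : ∀ e .{{_ : NonZero e}} → ¬ ((+ e) ≡ (+ 1) [mod suc n ]) → S (n ℕ.+ e) ≈ 0#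
  e≢1⇒S[p-2+e]≈0 (suc e) e≢1 = begin
    S (n ℕ.+ suc e)   ≡⟨ cong S (ℕ.+-suc n e) ⟩
    S (suc n ℕ.+ e)   ≈⟨ p-1∤e⇒S[e]≈0 (suc n ℕ.+ e) (λ p-1∣ → e≢1 (ℕ.∣m+n∣m⇒∣n p-1∣ ℕ.∣-refl)) ⟩
    0#                ∎

  e≡1⇒[+a]^e≈+a : ∀ e .{{_ : NonZero e}} → (+ e) ≡ (+ 1) [mod suc n ] → ∀ a → (+ a) ^ e ≈ + a
  e≡1⇒[+a]^e≈+a (suc e) (divides t e≡t*[p-1]) a = begin
    (+ a) ^ suc e               ≡⟨ cong (λ k → (+ a) ^ suc k) e≡t*[p-1] ⟩
    (+ a) ^ suc (t ℕ.* suc n)   ≈⟨ x^[1+m]≈x⇒x^[1+k+t*m]≈x^[1+k] {+ a} {suc n} ([+a]^p≈+a a) 0 t ⟩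
    (+ a) ^ 1                   ≈⟨ *-identityʳ (+ a) ⟩
    + a                         ∎

  ^ᶻ≡^ : ∀ x k → x ^ᶻ k ≡ x ^ k
  ^ᶻ≡^ x zero    = ≡.refl
  ^ᶻ≡^ x (suc k) = cong (x *_) (^ᶻ≡^ x k)

  module _ (h : ℕ) where

    W : ℕ → ℤ
    W m = ∑[ a < p ] ((+ toℕ a) ^ n * altSum (+ toℕ a) h m)

    W-step : ∀ m → W (suc m) ≈ W m + (- 1#) ^ m * S (n ℕ.+ h ℕ.^ m)
    W-step m = begin
      W (suc m)
        ≈⟨ sum-cong-≋ {p} (λ a → split (+ toℕ a)) ⟩
      ∑[ a < p ] ((+ toℕ a) ^ n * altSum (+ toℕ a) h m + σ * (+ toℕ a) ^ (n ℕ.+ e))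
        ≈⟨ ∑-distrib-+ {p} (λ a → (+ toℕ a) ^ n * altSum (+ toℕ a) h m) (λ a → σ * (+ toℕ a) ^ (n ℕ.+ e)) ⟩
      W m + ∑[ a < p ] (σ * (+ toℕ a) ^ (n ℕ.+ e))
        ≈⟨ +-congˡ {W m} (*-distribˡ-sum {p} σ (λ a → (+ toℕ a) ^ (n ℕ.+ e))) ⟨
      W m + σ * S (n ℕ.+ e) ∎
      where
      σ : ℤ
      σ = (- 1#) ^ m
      e : ℕ
      e = h ℕ.^ m
      split : ∀ x → x ^ n * altSum x h (suc m) ≈ x ^ n * altSum x h m + σ * x ^ (n ℕ.+ e)
      split x = begin
        x ^ n * (altSum x h m + (- 1#) ^ᶻ m * x ^ᶻ e)     ≈⟨ distribˡ (x ^ n) (altSum x h m) _ ⟩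
        x ^ n * altSum x h m + x ^ n * ((- 1#) ^ᶻ m * x ^ᶻ e)
          ≡⟨ cong₂ (λ s t → x ^ n * altSum x h m + x ^ n * (s * t)) (^ᶻ≡^ (- 1#) m) (^ᶻ≡^ x e) ⟩
        x ^ n * altSum x h m + x ^ n * (σ * x ^ e)        ≈⟨ +-congˡ {x ^ n * altSum x h m} (x∙yz≈y∙xz (x ^ n) σ (x ^ e)) ⟩
        x ^ n * altSum x h m + σ * (x ^ n * x ^ e)        ≈⟨ +-congˡ {x ^ n * altSum x h m} (*-congˡ {σ} (^-homo-* x n e)) ⟨
        x ^ n * altSum x h m + σ * x ^ (n ℕ.+ e)          ∎

    W≈-1 : ∀ m → (∀ i → 0 < i → i ≤ m → S (n ℕ.+ h ℕ.^ i) ≈ 0#) → W (suc m) ≈ - 1#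
    W≈-1 zero _ = begin
      W 1                      ≈⟨ W-step 0 ⟩
      W 0 + 1# * S (n ℕ.+ 1)   ≈⟨ +-cong (sum-≈0 {p} _ (λ a → zeroʳ ((+ toℕ a) ^ n))) (*-identityˡ (S (n ℕ.+ 1))) ⟩
      0# + S (n ℕ.+ 1)         ≈⟨ +-identityˡ (S (n ℕ.+ 1)) ⟩
      S (n ℕ.+ 1)              ≡⟨ cong S (ℕ.+-comm n 1) ⟩
      S (suc n)                ≈⟨ S[p-1]≈-1 ⟩
      - 1#                     ∎
    W≈-1 (suc m) vanish = begin
      W (suc (suc m))                          ≈⟨ W-step (suc m) ⟩
      W (suc m) + σ * S (n ℕ.+ h ℕ.^ suc m)
        ≈⟨ +-cong (W≈-1 m (λ i 0<i i≤m → vanish i 0<i (ℕ.m≤n⇒m≤1+n i≤m)))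
                  (trans (*-congˡ {σ} (vanish (suc m) z<s ℕ.≤-refl)) (zeroʳ σ)) ⟩
      - 1# + 0#                                ≈⟨ +-identityʳ (- 1#) ⟩
      - 1#                                     ∎
      where
      σ : ℤ
      σ = (- 1#) ^ suc m

    ∃altSum≉0 : ∀ {l} → 0 < h → IsMultOrder h (suc n) l → ∃ λ (a : Fin p) → ¬ (altSum (+ toℕ a) h l ≈ 0#)
    ∃altSum≉0 {suc l} 0<h (_ , _ , minimal) =
      ¬∀⟶∃¬ p _ (λ a → altSum (+ toℕ a) h (suc l) ≈? 0#) all-zero-absurd
      where
      vanish : ∀ i → 0 < i → i ≤ l → S (n ℕ.+ h ℕ.^ i) ≈ 0#
      vanish i 0<i i≤l = e≢1⇒S[p-2+e]≈0 (h ℕ.^ i) {{ℕ.m^n≢0 h i {{ℕ.>-nonZero 0<h}}}}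
        (ℕ.<⇒≱ (s≤s i≤l) ∘ minimal i 0<i)
      all-zero-absurd : ¬ (∀ a → altSum (+ toℕ a) h (suc l) ≈ 0#)
      all-zero-absurd all-zero = -1≉0 (begin
        - 1#        ≈⟨ W≈-1 l vanish ⟨
        W (suc l)   ≈⟨ sum-≈0 {p} _ (λ a → trans (*-congˡ {(+ toℕ a) ^ n} (all-zero a)) (zeroʳ ((+ toℕ a) ^ n))) ⟩
        0#          ∎)

    [+a]^[h^l]≈+a : ∀ {l} → 0 < h → IsMultOrder h (suc n) l → ∀ a → (+ a) ^ᶻ (h ℕ.^ l) ≈ + a
    [+a]^[h^l]≈+a {l} 0<h (_ , h^l≡1 , _) a =
      subst (_≈ + a) (≡.sym (^ᶻ≡^ (+ a) (h ℕ.^ l))) (e≡1⇒[+a]^e≈+a (h ℕ.^ l) {{ℕ.m^n≢0 h l {{ℕ.>-nonZero 0<h}}}} h^l≡1 a)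

open import Data.Nat using (_∸_; _^_)
open import Data.Nat.Coprimality using (Coprime)
open import Data.Product using (Σ; _×_)

-- Coprimality of h and q − 1 is implied by the order hypothesis.
lemma2p6 : (q h l : ℕ) → Prime q → 0 < h → Coprime h (q ∸ 1) → IsMultOrder h (q ∸ 1) l →
    Σ ℕ (λ a → (a < q) × (((+ a) ^ᶻ (h ^ l)) ≡ (+ a) [mod q ]) × ¬ (altSum (+ a) h l ≡ (+ 0) [mod q ]))
lemma2p6 zero          _ _ q-prime _ _ _ = contradiction q-prime ¬prime[0]
lemma2p6 (suc zero)    _ _ q-prime _ _ _ = contradiction q-prime ¬prime[1]
lemma2p6 (suc (suc n)) h l q-prime 0<h _ order
  with PrimeField.∃altSum≉0 n q-prime h 0<h order
... | a , altSum≉0 =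
  toℕ a , toℕ<n a , ModEq.unmod (PrimeField.[+a]^[h^l]≈+a n q-prime h 0<h order (toℕ a)) , altSum≉0 ∘ mod
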